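{- Suppose $y,z\in{}^\omega(\omega\setminus\{0\})$ with $y\ll z$, and for each $n\in\omega$, $T_n$ is a $y$-sized tree. Then there are a $z$-sized tree $T^*$ and an increasing sequence of integers $\langle k_n : n\in\omega\rangle$ with $n<k_n$ for all $n$, such that for every $f\in{}^\omega\omega$: $(\forall n\in\omega)(\exists i\leq n)(f\restriction k_n\in T_{k_i})$ if and only if $f\in[T^*]$.
   Context: A tree is a subset $T\subseteq{}^{<\omega}\omega$ closed under initial segments. For $x\in{}^\omega(\omega\setminus\{0\})$, $T$ is an $x$-sized tree if $|T\cap{}^n\omega|\leq x(n)$ for every $n\in\omega$. $[T]$ is the set of $f\in{}^\omega\omega$ all of whose finite initial segments lie in $T$. For $x,y\in{}^\omega(\omega\setminus\{0\})$, $x\ll y$ means $x(n)\leq y(n)$ for all $n$ and $\lim_{n\to\infty}y(n)/x(n)=\infty$. -}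

module Defs where

open import Data.Nat using (ℕ; _≤_; _<_; _*_)
open import Data.List using (List; length; take; map; upTo)
open import Data.List.Relation.Unary.All using (All)
open import Data.List.Relation.Unary.Unique.Propositional using (Unique)
open import Data.Product using (Σ; _×_; ∃)
open import Relation.Binary.PropositionalEquality using (_≡_)

record Tree : Set₁ where
  field
    mem    : List ℕ → Set
    closed : ∀ (s : List ℕ) (k : ℕ) → mem s → mem (take k s)
open Tree public

-- |T ∩ ω^n| ≤ x n : every duplicate-free list of members of T of length n
-- has at most x n entries.
Sized : (ℕ → ℕ) → Tree → Set
Sized x T = ∀ (n : ℕ) (l : List (List ℕ)) → Unique l
          → All (λ s → length s ≡ n × mem T s) l → length l ≤ x n

_↾_ : (ℕ → ℕ) → ℕ → List ℕ
f ↾ k = map f (upTo k)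

Body : Tree → (ℕ → ℕ) → Set
Body T f = ∀ (n : ℕ) → mem T (f ↾ n)

-- x ≪ y : x(n) ≤ y(n) for all n, and y(n)/x(n) → ∞, i.e. for every M,
-- eventually M · x(n) ≤ y(n)  (equivalent since x(n) > 0).
_≪_ : (ℕ → ℕ) → (ℕ → ℕ) → Set
x ≪ y = (∀ n → x n ≤ y n)
      × (∀ (M : ℕ) → ∃ λ N → ∀ n → N ≤ n → M * x n ≤ y n)

{-# OPTIONS --safe #-}
module Submission where

open import Defs
open import Level using (Level)
open import Data.Nat using (ℕ; zero; suc; _+_; _*_; _⊓_; _≤_; _<_; z≤n; s≤s; _≤?_)
open import Data.Nat.Properties
open import Data.Product using (Σ; _×_; ∃; _,_; proj₁; proj₂)
open import Data.Sum using (_⊎_; inj₁; inj₂)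
open import Data.List using (List; []; _∷_; length; take; map; upTo; applyUpTo)
open import Data.List.Properties using (take-take; take-all; map-upTo)
open import Data.List.Relation.Unary.All as All using (All; []; _∷_)
open import Data.List.Relation.Unary.Unique.Propositional using (Unique)
open import Data.List.Relation.Unary.AllPairs using ([]; _∷_)
open import Data.List.Relation.Binary.Sublist.Propositional using (_⊆_; []; _∷_; _∷ʳ_)
open import Data.List.Relation.Binary.Sublist.Propositional.Properties using (All-resp-⊆)
open import Relation.Unary using (Pred; _∪_; _⇒_; IUniversal)
open import Relation.Binary.PropositionalEquality
  using (_≡_; refl; sym; trans; cong; subst; module ≡-Reasoning)
open import Relation.Nullary using (yes; no; contradiction)
open import Function using (_∘_)
open import Function.Bundles using (_⇔_; mk⇔)

-- Let T* consist of the s with s ↾ k n ∈ T (k 0) ∪ … ∪ T (k n) for every n;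
-- this is a tree, and f ∈ [T*] is exactly the condition on f. A node of T* of
-- height m ≤ k n lies in one of those n + 1 trees, so level m of T* has at most
-- (n + 1) · y m elements. Taking the least such n, m > k (n - 1), and k is
-- chosen to grow so fast that beyond k (n - 1) already (n + 1) · y ≤ z.

private
  variable
    a p q : Level
    A : Set a

Unique-resp-⊆ : {xs ys : List A} → xs ⊆ ys → Unique ys → Unique xs
Unique-resp-⊆ []         []         = []
Unique-resp-⊆ (_ ∷ʳ xs⊆) (_ ∷ u)    = Unique-resp-⊆ xs⊆ u
Unique-resp-⊆ (refl ∷ xs⊆) (x≢ ∷ u) = All-resp-⊆ xs⊆ x≢ ∷ Unique-resp-⊆ xs⊆ u

Bounded : ℕ → Pred A p → Set _
Bounded {A = A} c P = ∀ (xs : List A) → Unique xs → All P xs → length xs ≤ c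

Bounded-resp-⇒ : {P : Pred A p} {Q : Pred A q} {c : ℕ} →
                 ∀[ P ⇒ Q ] → Bounded c Q → Bounded c P
Bounded-resp-⇒ P⇒Q bound xs u all = bound xs u (All.map P⇒Q all)

Bounded-mono-≤ : {P : Pred A p} {b c : ℕ} → b ≤ c → Bounded b P → Bounded c P
Bounded-mono-≤ b≤c bound xs u all = ≤-trans (bound xs u all) b≤c

split-∪ : {P : Pred A p} {Q : Pred A q} (xs : List A) → All (P ∪ Q) xs →
          Σ (List A) λ ys → Σ (List A) λ zs →
            ys ⊆ xs × zs ⊆ xs × All P ys × All Q zs
            × length xs ≡ length ys + length zs
split-∪ [] [] = [] , [] , [] , [] , [] , [] , refl
split-∪ (x ∷ xs) (px⊎qx ∷ all) with split-∪ xs all | px⊎qx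
... | ys , zs , ys⊆ , zs⊆ , Pys , Qzs , eq | inj₁ px =
  x ∷ ys , zs , refl ∷ ys⊆ , x ∷ʳ zs⊆ , px ∷ Pys , Qzs , cong suc eq
... | ys , zs , ys⊆ , zs⊆ , Pys , Qzs , eq | inj₂ qx =
  ys , x ∷ zs , x ∷ʳ ys⊆ , refl ∷ zs⊆ , Pys , qx ∷ Qzs ,
  trans (cong suc eq) (sym (+-suc (length ys) (length zs)))

Bounded-∪ : {P : Pred A p} {Q : Pred A q} {b c : ℕ} →
            Bounded b P → Bounded c Q → Bounded (b + c) (P ∪ Q)
Bounded-∪ boundP boundQ xs u all with split-∪ xs all
... | ys , zs , ys⊆ , zs⊆ , Pys , Qzs , eq = subst (_≤ _) (sym eq)
  (+-mono-≤ (boundP ys (Unique-resp-⊆ ys⊆ u) Pys)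
            (boundQ zs (Unique-resp-⊆ zs⊆ u) Qzs))

Bounded-⋃≤ : {Q : ℕ → Pred A p} {c : ℕ} → (∀ i → Bounded c (Q i)) →
             ∀ n → Bounded (suc n * c) (λ x → ∃ λ i → i ≤ n × Q i x)
Bounded-⋃≤ {c = c} bound zero =
  Bounded-resp-⇒ (λ { (.0 , z≤n , q) → q })
    (Bounded-mono-≤ (≤-reflexive (sym (+-identityʳ c))) (bound 0))
Bounded-⋃≤ {Q = Q} bound (suc n) =
  Bounded-resp-⇒ lastOrEarlier (Bounded-∪ (bound (suc n)) (Bounded-⋃≤ bound n))
  where
  lastOrEarlier : ∀[ (λ x → ∃ λ i → i ≤ suc n × Q i x) ⇒
                     (Q (suc n) ∪ (λ x → ∃ λ i → i ≤ n × Q i x)) ]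
  lastOrEarlier (i , i≤1+n , qi) with m≤n⇒m<n∨m≡n i≤1+n
  ... | inj₁ (s≤s i≤n) = inj₂ (i , i≤n , qi)
  ... | inj₂ refl      = inj₁ qi

take-take-comm : ∀ m n (xs : List A) → take m (take n xs) ≡ take n (take m xs)
take-take-comm m n xs = begin
  take m (take n xs) ≡⟨ take-take m n xs ⟩
  take (m ⊓ n) xs    ≡⟨ cong (λ j → take j xs) (⊓-comm m n) ⟩
  take (n ⊓ m) xs    ≡⟨ sym (take-take n m xs) ⟩
  take n (take m xs) ∎
  where open ≡-Reasoning

take-applyUpTo : ∀ (f : ℕ → A) j m → take j (applyUpTo f m) ≡ applyUpTo f (j ⊓ m)
take-applyUpTo f zero    m       = refl
take-applyUpTo f (suc j) zero    = refl
take-applyUpTo f (suc j) (suc m) = cong (f 0 ∷_) (take-applyUpTo (f ∘ suc) j m)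

take-↾ : ∀ (f : ℕ → ℕ) j m → take j (f ↾ m) ≡ f ↾ (j ⊓ m)
take-↾ f j m = begin
  take j (map f (upTo m))  ≡⟨ cong (take j) (map-upTo f m) ⟩
  take j (applyUpTo f m)   ≡⟨ take-applyUpTo f j m ⟩
  applyUpTo f (j ⊓ m)      ≡⟨ sym (map-upTo f (j ⊓ m)) ⟩
  map f (upTo (j ⊓ m))     ∎
  where open ≡-Reasoning

take-↾-comm : ∀ (f : ℕ → ℕ) j m → take j (f ↾ m) ≡ take m (f ↾ j)
take-↾-comm f j m = begin
  take j (f ↾ m)  ≡⟨ take-↾ f j m ⟩
  f ↾ (j ⊓ m)     ≡⟨ cong (f ↾_) (⊓-comm j m) ⟩
  f ↾ (m ⊓ j)     ≡⟨ sym (take-↾ f m j) ⟩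
  take m (f ↾ j)  ∎
  where open ≡-Reasoning

take-↾-self : ∀ (f : ℕ → ℕ) m → take m (f ↾ m) ≡ f ↾ m
take-↾-self f m = trans (take-↾ f m m) (cong (f ↾_) (⊓-idem m))

-- Sized x T unfolds to ∀ m → Bounded (x m) (Level-at T m).
Level-at : Tree → ℕ → Pred (List ℕ) _
Level-at T m s = length s ≡ m × mem T s

⋃≤ : (ℕ → Tree) → ℕ → Tree
⋃≤ T n = record
  { mem    = λ s → ∃ λ i → i ≤ n × mem (T i) s
  ; closed = λ { s j (i , i≤n , s∈Ti) → i , i≤n , closed (T i) s j s∈Ti }
  }

⋃≤-sized : ∀ {x : ℕ → ℕ} {T : ℕ → Tree} → (∀ i → Sized x (T i)) →
           ∀ n → Sized (λ m → suc n * x m) (⋃≤ T n)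
⋃≤-sized sized n m =
  Bounded-resp-⇒ (λ { (refl , i , i≤n , s∈Ti) → i , i≤n , refl , s∈Ti })
    (Bounded-⋃≤ (λ i → sized i m) n)

Staged : (ℕ → Tree) → (ℕ → ℕ) → Tree
Staged S k = record
  { mem    = λ s → ∀ n → mem (S n) (take (k n) s)
  ; closed = λ s j s∈ n → subst (mem (S n)) (take-take-comm j (k n) s)
                            (closed (S n) (take (k n) s) j (s∈ n))
  }

Staged-level-bound : ∀ {S : ℕ → Tree} {k : ℕ → ℕ} {m n c : ℕ} → m ≤ k n →
                     Bounded c (Level-at (S n) m) →
                     Bounded c (Level-at (Staged S k) m)
Staged-level-bound {S} {k} {n = n} m≤kn =
  Bounded-resp-⇒ λ { {s} (refl , s∈) →
    refl , subst (mem (S n)) (take-all (k n) s m≤kn) (s∈ n) }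

Body-Staged : ∀ (S : ℕ → Tree) (k : ℕ → ℕ) (f : ℕ → ℕ) →
              (∀ n → mem (S n) (f ↾ k n)) ⇔ Body (Staged S k) f
Body-Staged S k f = mk⇔
  (λ f∈ m n → subst (mem (S n)) (sym (take-↾-comm f (k n) m))
                (closed (S n) (f ↾ k n) m (f∈ n)))
  (λ f∈ n → subst (mem (S n)) (take-↾-self f (k n)) (f∈ (k n) n))

majorant : (ℕ → ℕ) → ℕ → ℕ
majorant g zero    = suc (g zero)
majorant g (suc n) = suc (majorant g n + g (suc n))

majorant-< : ∀ g n → majorant g n < majorant g (suc n)
majorant-< g n = s≤s (m≤m+n (majorant g n) (g (suc n)))

≤-majorant : ∀ g n → g n ≤ majorant g n
≤-majorant g zero    = n≤1+n (g zero)
≤-majorant g (suc n) = m≤n⇒m≤1+n (m≤n+m (g (suc n)) (majorant g n))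

<-majorant : ∀ g n → n < majorant g n
<-majorant g zero    = s≤s z≤n
<-majorant g (suc n) = <-≤-trans (s≤s (<-majorant g n)) (majorant-< g n)

locate : (k : ℕ → ℕ) → (∀ n → n < k n) →
         ∀ m → m ≤ k 0 ⊎ ∃ λ n → k n < m × m ≤ k (suc n)
locate k n<k m with below m
  where
  below : ∀ j → (m ≤ k 0 ⊎ ∃ λ n → k n < m × m ≤ k (suc n)) ⊎ k j < m
  below zero with m ≤? k 0
  ... | yes m≤k0 = inj₁ (inj₁ m≤k0)
  ... | no  m≰k0 = inj₂ (≰⇒> m≰k0)
  below (suc j) with below j
  ... | inj₁ found = inj₁ found
  ... | inj₂ kj<m with m ≤? k (suc j)
  ...   | yes m≤ = inj₁ (inj₂ (j , kj<m , m≤))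
  ...   | no  m≰ = inj₂ (≰⇒> m≰)
... | inj₁ found = found
... | inj₂ km<m  = contradiction km<m (<-asym (n<k m))

lemma4p5 : (y z : ℕ → ℕ) → (∀ n → 0 < y n) → (∀ n → 0 < z n) → y ≪ z
    → (T : ℕ → Tree) → (∀ n → Sized y (T n))
    → Σ Tree λ T* → Sized z T*
    × Σ (ℕ → ℕ) λ k → (∀ n → k n < k (suc n)) × (∀ n → n < k n)
    × (∀ (f : ℕ → ℕ)
    → (∀ n → ∃ λ i → i ≤ n × mem (T (k i)) (f ↾ k n)) ⇔ Body T* f)
lemma4p5 y z _ _ (y≤z , eventually) T sized =
  Staged (⋃≤ (T ∘ k)) k , sized* , k , majorant-< g , <-majorant g ,
  Body-Staged (⋃≤ (T ∘ k)) k
  where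
  g : ℕ → ℕ
  g n = proj₁ (eventually (suc (suc n)))

  k : ℕ → ℕ
  k = majorant g

  cover : ∀ m → ∃ λ n → m ≤ k n × suc n * y m ≤ z m
  cover m with locate k (<-majorant g) m
  ... | inj₁ m≤k0 = 0 , m≤k0 , subst (_≤ z m) (sym (+-identityʳ (y m))) (y≤z m)
  ... | inj₂ (n , kn<m , m≤) =
    suc n , m≤ ,
    proj₂ (eventually (suc (suc n))) m (≤-trans (≤-majorant g n) (<⇒≤ kn<m))

  sized* : Sized z (Staged (⋃≤ (T ∘ k)) k)
  sized* m with cover m
  ... | n , m≤kn , bound = Bounded-mono-≤ bound
    (Staged-level-bound {S = ⋃≤ (T ∘ k)} {k} {n = n} m≤kn
      (⋃≤-sized {y} {T ∘ k} (sized ∘ k) n m))
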